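{- Let $m\ge 2$, let $D_1,\dots,D_m$ be propositional clauses (not necessarily distinct), and let $x_1,\dots,x_{m-1}$ be literals. Suppose that for each $i$ a sub-clause $D_i^-\subseteq D_i$ is given with $D_1^-=\{x_1\}$; $D_i^-=\{x_i,\neg x_{i-1}\}\cup D^i$ for $2\le i\le m-1$; and $D_m^-=\{\neg x_{m-1}\}\cup D^m$, where $D^2=\emptyset$ and $D^j\subseteq\{\neg x_1,\dots,\neg x_{j-2}\}$ for $3\le j\le m$. Then the contradiction based on standard extension $\bigwedge_{i=1}^m D_i^-$ is a standard contradiction; that is, for every tuple $(p_1,\dots,p_m)$ with $p_i\in D_i^-$ for all $i$, there exist indices $i,j$ such that $p_i$ and $p_j$ are complementary.
   Context: Propositional logic. A literal is a propositional variable $p$ or its negation $\neg p$; $p$ and $\neg p$ form a complementary pair (and $\neg\neg p$ is identified with $p$). A clause is a finite disjunction of literals, identified with the finite set of its literals. A finite list of clauses $E_1,\dots,E_m$ (conjunction $\bigwedge_{i=1}^m E_i$) is called a standard contradiction if for every $(p_1,\dots,p_m)\in E_1\times\cdots\times E_m$ there is at least one complementary pair among $p_1,\dots,p_m$. The conjunction $\bigwedge_{i=1}^m D_i^-$ built as in the claim is called a contradiction based on standard extension of $D_1,\dots,D_m$. -}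

module Defs where

open import Data.Nat using (ℕ; _≤_; _∸_)
open import Data.List using (List)
open import Data.List.Membership.Propositional using (_∈_)
open import Data.Product using (_×_; ∃-syntax)
open import Data.Sum using (_⊎_)
open import Relation.Binary.PropositionalEquality using (_≡_)

data Literal (V : Set) : Set where
  pos : V → Literal V
  neg : V → Literal V

-- Negation on literals (so that ¬¬p = p holds definitionally).
∼_ : {V : Set} → Literal V → Literal V
∼ pos v = neg v
∼ neg v = pos v

-- A clause is a finite set of literals, represented as a list (up to membership).
Clause : Set → Set
Clause V = List (Literal V)

_⊆ᶜ_ : {V : Set} → Clause V → Clause V → Set
C ⊆ᶜ D = ∀ {l} → l ∈ C → l ∈ D

Complementary : {V : Set} → Literal V → Literal V → Set
Complementary p q = q ≡ ∼ p

-- Standard contradiction for a list of clauses E₁,…,Eₘ given as an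
-- ℕ-indexed family (1-based, indices 1..m used).
StandardContradiction : {V : Set} → ℕ → (ℕ → Clause V) → Set
StandardContradiction {V} m E =
  (p : ℕ → Literal V) →
  (∀ i → 1 ≤ i → i ≤ m → p i ∈ E i) →
  ∃[ i ] ∃[ j ] ((1 ≤ i × i ≤ m) × (1 ≤ j × j ≤ m) × Complementary (p i) (p j))

-- Every clause D⁻ᵢ with i ≥ 2 consists of literals that either continue the chain (xᵢ, only for
-- i < m) or negate some earlier xₖ. Choosing one literal pᵢ per clause, p₁ = x₁, so either the
-- choice follows the chain x₁, …, x_{m−1} throughout, and then pₘ = ¬xₖ clashes with pₖ = xₖ, or
-- it leaves the chain at some first index i, where pᵢ = ¬xₖ with k < i clashes with pₖ = xₖ.
module Submission where

open import Defs
open import Data.Nat using (ℕ; zero; suc; _≤_; _<_; _∸_; _+_; s≤s; z≤n; z<s)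
open import Data.Nat.Properties
  using (≤-refl; ≤-trans; ≤-pred; n≤1+n; m≤n⇒m≤1+n; m≤n⇒m<n∨m≡n; <-≤-trans; m<m+n; +-comm)
open import Data.List.Membership.Propositional using (_∈_)
open import Data.Product using (_×_; ∃-syntax; _,_; proj₁)
open import Data.Sum using (_⊎_; inj₁; inj₂)
open import Data.Empty using (⊥-elim)
open import Relation.Binary.PropositionalEquality using (_≡_; refl; sym; trans; cong; subst)
open import Relation.Nullary using (¬_)

Clash : {V : Set} → ℕ → (ℕ → Literal V) → Set
Clash n p = ∃[ i ] ∃[ j ] ((1 ≤ i × i ≤ n) × (1 ≤ j × j ≤ n) × Complementary (p i) (p j))

NegatesEarlier : {V : Set} → (ℕ → Literal V) → ℕ → Literal V → Set
NegatesEarlier x i l = ∃[ k ] ((1 ≤ k × k < i) × l ≡ ∼ x k)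

module _ {V : Set} (x p : ℕ → Literal V) where

  AgreesUpTo : ℕ → Set
  AgreesUpTo n = ∀ k → 1 ≤ k → k ≤ n → p k ≡ x k

  clash-mono : ∀ {n n′} → n ≤ n′ → Clash n p → Clash n′ p
  clash-mono n≤n′ (i , j , (1≤i , i≤n) , (1≤j , j≤n) , c) =
    i , j , (1≤i , ≤-trans i≤n n≤n′) , (1≤j , ≤-trans j≤n n≤n′) , c

  agreesUpTo-suc : ∀ {n} → AgreesUpTo n → p (suc n) ≡ x (suc n) → AgreesUpTo (suc n)
  agreesUpTo-suc agrees eq k 1≤k k≤1+n with m≤n⇒m<n∨m≡n k≤1+n
  ... | inj₁ k<1+n = agrees k 1≤k (≤-pred k<1+n)
  ... | inj₂ refl  = eq

  negatesEarlier-clash : ∀ {n} → AgreesUpTo n →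
    NegatesEarlier x (suc n) (p (suc n)) → Clash (suc n) p
  negatesEarlier-clash {n} agrees (k , (1≤k , k<1+n) , eq) =
    k , suc n , (1≤k , m≤n⇒m≤1+n k≤n) , (s≤s z≤n , ≤-refl) ,
    trans eq (cong ∼_ (sym (agrees k 1≤k k≤n)))
    where k≤n = ≤-pred k<1+n

  -- At i = 1 no earlier literal exists, so a chain step forces p 1 ≡ x 1.
  ChainStep : ℕ → Set
  ChainStep n = ∀ i → 1 ≤ i → i ≤ n → p i ≡ x i ⊎ NegatesEarlier x i (p i)

  agreesUpTo⊎clash : ∀ n → ChainStep n → AgreesUpTo n ⊎ Clash n p
  agreesUpTo⊎clash zero    _    = inj₁ λ { _ (s≤s _) () }
  agreesUpTo⊎clash (suc n) step
    with agreesUpTo⊎clash n (λ i 1≤i i≤n → step i 1≤i (m≤n⇒m≤1+n i≤n))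
  ... | inj₂ clash  = inj₂ (clash-mono (n≤1+n n) clash)
  ... | inj₁ agrees with step (suc n) (s≤s z≤n) ≤-refl
  ...   | inj₁ eq      = inj₁ (agreesUpTo-suc agrees eq)
  ...   | inj₂ negates = inj₂ (negatesEarlier-clash agrees negates)

  chain-clash : ∀ n → ChainStep n → NegatesEarlier x (suc n) (p (suc n)) → Clash (suc n) p
  chain-clash n step last with agreesUpTo⊎clash n step
  ... | inj₁ agrees = negatesEarlier-clash agrees last
  ... | inj₂ clash  = clash-mono (n≤1+n n) clash

chain-standardContradiction : {V : Set} (n : ℕ) (E : ℕ → Clause V) (x : ℕ → Literal V) →
  (∀ i → 1 ≤ i → i ≤ n → ∀ {l} → l ∈ E i → l ≡ x i ⊎ NegatesEarlier x i l) →
  (∀ {l} → l ∈ E (suc n) → NegatesEarlier x (suc n) l) →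
  StandardContradiction (suc n) E
chain-standardContradiction n E x inner last p p∈E =
  chain-clash x p n (λ i 1≤i i≤n → inner i 1≤i i≤n (p∈E i 1≤i (m≤n⇒m≤1+n i≤n)))
                    (last (p∈E (suc n) (s≤s z≤n) ≤-refl))

negatesEarlier-pred : {V : Set} (x : ℕ → Literal V) → ∀ i → 2 ≤ i → NegatesEarlier x i (∼ x (i ∸ 1))
negatesEarlier-pred x (suc (suc j)) (s≤s (s≤s z≤n)) = suc j , (s≤s z≤n , ≤-refl) , refl

negatesEarlier-weaken : {V : Set} {x : ℕ → Literal V} {i : ℕ} {l : Literal V} →
  ∃[ k ] ((1 ≤ k × k + 2 ≤ i) × l ≡ ∼ x k) → NegatesEarlier x i l
negatesEarlier-weaken (k , (1≤k , k+2≤i) , eq) = k , (1≤k , <-≤-trans (m<m+n k z<s) k+2≤i) , eq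

theorem4p1 : {V : Set} (m : ℕ) → 2 ≤ m →
    (D D⁻ Dᵘ : ℕ → Clause V) (x : ℕ → Literal V) →
    (∀ i → 1 ≤ i → i ≤ m → D⁻ i ⊆ᶜ D i) →
    (∀ l → l ∈ D⁻ 1 → l ≡ x 1) → (x 1 ∈ D⁻ 1) →
    (∀ i → 2 ≤ i → i + 1 ≤ m → ∀ l →
      (l ∈ D⁻ i → (l ≡ x i ⊎ l ≡ ∼ x (i ∸ 1) ⊎ l ∈ Dᵘ i))
      × ((l ≡ x i ⊎ l ≡ ∼ x (i ∸ 1) ⊎ l ∈ Dᵘ i) → l ∈ D⁻ i)) →
    (∀ l →
      (l ∈ D⁻ m → (l ≡ ∼ x (m ∸ 1) ⊎ l ∈ Dᵘ m))
      × ((l ≡ ∼ x (m ∸ 1) ⊎ l ∈ Dᵘ m) → l ∈ D⁻ m)) →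
    (∀ l → ¬ (l ∈ Dᵘ 2)) →
    (∀ j → 3 ≤ j → j ≤ m → ∀ l → l ∈ Dᵘ j →
      ∃[ k ] ((1 ≤ k × k + 2 ≤ j) × l ≡ ∼ x k)) →
    StandardContradiction m D⁻
theorem4p1 (suc (suc n)) (s≤s (s≤s z≤n)) D D⁻ Dᵘ x _ first _ middle last noExtra₂ extra =
  chain-standardContradiction (suc n) D⁻ x inner final
  where
  extraNegatesEarlier : ∀ i → 2 ≤ i → i ≤ suc (suc n) → ∀ {l} → l ∈ Dᵘ i → NegatesEarlier x i l
  extraNegatesEarlier (suc (suc zero))    (s≤s (s≤s z≤n)) _   l∈ = ⊥-elim (noExtra₂ _ l∈)
  extraNegatesEarlier (suc (suc (suc j))) (s≤s (s≤s z≤n)) i≤m l∈ =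
    negatesEarlier-weaken (extra (suc (suc (suc j))) (s≤s (s≤s (s≤s z≤n))) i≤m _ l∈)

  inner : ∀ i → 1 ≤ i → i ≤ suc n → ∀ {l} → l ∈ D⁻ i → l ≡ x i ⊎ NegatesEarlier x i l
  inner (suc zero) _ _ l∈ = inj₁ (first _ l∈)
  inner i@(suc (suc _)) _ i≤1+n {l} l∈ with proj₁ (middle i (s≤s (s≤s z≤n)) i+1≤m l) l∈
    where i+1≤m = subst (_≤ suc (suc n)) (+-comm 1 i) (s≤s i≤1+n)
  ... | inj₁ eq          = inj₁ eq
  ... | inj₂ (inj₁ refl) = inj₂ (negatesEarlier-pred x i (s≤s (s≤s z≤n)))
  ... | inj₂ (inj₂ l∈ᵘ)  = inj₂ (extraNegatesEarlier i (s≤s (s≤s z≤n)) (m≤n⇒m≤1+n i≤1+n) l∈ᵘ)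

  final : ∀ {l} → l ∈ D⁻ (suc (suc n)) → NegatesEarlier x (suc (suc n)) l
  final {l} l∈ with proj₁ (last l) l∈
  ... | inj₁ refl = negatesEarlier-pred x (suc (suc n)) (s≤s (s≤s z≤n))
  ... | inj₂ l∈ᵘ  = extraNegatesEarlier (suc (suc n)) (s≤s (s≤s z≤n)) ≤-refl l∈ᵘ
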